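{- Let $k\ge0$ and $n,p\ge0$ be integers. The number of words $\pi\in[2k+1]^n$ with $\overleftarrow{\mathrm{des}}_E(\pi)=p$, which also equals the number of words $\pi\in[2k+1]^n$ with $\overleftarrow{\mathrm{ris}}_E(\pi)=p$, is $$\sum_{m=0}^n\sum_{j=0}^m\sum_{i=0}^j(-1)^{n+p+j}2^{m-i}\binom{m}{j}\binom{j}{i}\binom{kj}{n-i}\binom{n-m}{p}.$$
   Context: $[N]=\{1,\ldots,N\}$, $[N]^n$ is the set of words of length $n$ over $[N]$. $E=\{2,4,6,\ldots\}$. For a word $\pi=\pi_1\cdots\pi_n$ and $X\subseteq\mathbb{N}$, $\overleftarrow{\mathrm{des}}_X(\pi)=|\{i:\pi_i>\pi_{i+1},\ \pi_i\in X\}|$ and $\overleftarrow{\mathrm{ris}}_X(\pi)=|\{i:\pi_i<\pi_{i+1},\ \pi_i\in X\}|$. Convention: $\binom{a}{b}=0$ if $b<0$ or $b>a$ (for $a\ge0$). -}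

module Defs where

open import Data.Nat using (ℕ; zero; suc; _+_; _*_; _∸_; _^_; _<ᵇ_; _≡ᵇ_; _%_)
open import Data.Nat.Combinatorics using (_C_)
open import Data.Bool using (Bool; true; false; _∧_; if_then_else_)
open import Data.List using (List; []; _∷_; map; concatMap; length; filter; upTo)
open import Data.Integer as ℤ using (ℤ)
open import Relation.Binary.PropositionalEquality using (_≡_)

letters : ℕ → List ℕ
letters N = map suc (upTo N)

words : ℕ → ℕ → List (List ℕ)
words N zero    = [] ∷ []
words N (suc n) = concatMap (λ a → map (a ∷_) (words N n)) (letters N)

-- membership in E = {2,4,6,...}
isEven : ℕ → Bool
isEven a = a % 2 ≡ᵇ 0

desE : List ℕ → ℕ
desE []           = 0
desE (a ∷ [])     = 0
desE (a ∷ b ∷ w)  = (if (b <ᵇ a) ∧ isEven a then 1 else 0) + desE (b ∷ w)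

risE : List ℕ → ℕ
risE []           = 0
risE (a ∷ [])     = 0
risE (a ∷ b ∷ w)  = (if (a <ᵇ b) ∧ isEven a then 1 else 0) + risE (b ∷ w)

countStat : (List ℕ → ℕ) → ℕ → ℕ → ℕ → ℕ
countStat st N n p = length (filter (λ w → st w Data.Nat.≟ p) (words N n))

sumTo : ℕ → (ℕ → ℤ) → ℤ
sumTo zero    f = f 0
sumTo (suc n) f = sumTo n f ℤ.+ f (suc n)

sign : ℕ → ℤ
sign e = if e % 2 ≡ᵇ 0 then ℤ.+ 1 else ℤ.- (ℤ.+ 1)

-- the closed formula (binomials from Data.Nat.Combinatorics, which are 0 when b > a)
formula : ℕ → ℕ → ℕ → ℤ
formula k n p =
  sumTo n λ m → sumTo m λ j → sumTo j λ i →
    sign (n + p + j) ℤ.* ℤ.+ (2 ^ (m ∸ i) * (m C j) * (j C i) * ((k * j) C (n ∸ i)) * ((n ∸ m) C p))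

{-# OPTIONS --safe #-}
module Submission where

-- Let Fₙ = Σ X ^ des_E(π) over π ∈ [N]ⁿ.  Prepending a letter a to a word that starts with b multiplies
-- its weight by X = 1 + (X − 1) exactly when b < a and a is even; expanding these factors gives
-- Fₙ₊₁ = Σ_r c_r (X − 1)^r Fₙ₋ᵣ, where c_r counts the chains b₀ > b₁ > ⋯ > b_r in [N] with
-- b₀, …, b_{r−1} even.  For N = 2k + 1 one finds c_r = C(k, r) + 2 C(k, r + 1), so that
-- P(x) = (2 + x)(1 + x)^k = 2 + Σ_r c_r x^(r+1).  With F₀ = 1 this recurrence is also satisfied by
-- Σ_m [xⁿ] (P − 2)^m · (X − 1)^(n − m), because (P − 2)^(m+1) = (Σ_r c_r x^(r+1)) (P − 2)^m; expanding
-- (P − 2)^m, P^j and (X − 1)^(n − m) by the binomial theorem gives the stated sum.  The complement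
-- a ↦ N + 1 − a reverses the order of [N] and, N + 1 being even, preserves parity, so ris_E has the
-- same chain counts.

open import Defs
open import Data.Bool using (Bool; true; false; _∧_; if_then_else_)
open import Data.Nat as ℕ using (ℕ; zero; suc; _∸_; _^_; _≤_; _<_; z≤n; s≤s; _<ᵇ_)
import Data.Nat.Properties as ℕₚ
open import Data.Integer using (ℤ; +_)
import Data.Integer.Properties as ℤₚ
open import Data.Integer.Tactic.RingSolver using (solve-∀)
open import Function using (_∘_)
open import Relation.Binary.PropositionalEquality
open ≡-Reasoning

module ClosedFormula where

  open import Data.Integer using (-_; _+_; _*_; _-_; -1ℤ)
  open import Data.Nat.Combinatorics using (_C_; nCk+nC[k+1]≡[n+1]C[k+1]; k>n⇒nCk≡0)
  open import Data.Nat.DivMod using ([m+n]%n≡m%n)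
  open import Data.Nat.GeneralisedArithmetic using (fold)
  import Data.Nat.Tactic.RingSolver as ℕ-Solver

  sumTo-cong : ∀ n {f g : ℕ → ℤ} → (∀ i → i ≤ n → f i ≡ g i) → sumTo n f ≡ sumTo n g
  sumTo-cong zero    f≡g = f≡g 0 z≤n
  sumTo-cong (suc n) f≡g =
    cong₂ _+_ (sumTo-cong n (λ i i≤n → f≡g i (ℕₚ.m≤n⇒m≤1+n i≤n))) (f≡g (suc n) ℕₚ.≤-refl)

  sumTo-zero : ∀ n (f : ℕ → ℤ) → (∀ i → i ≤ n → f i ≡ + 0) → sumTo n f ≡ + 0
  sumTo-zero zero    f f≡0 = f≡0 0 z≤n
  sumTo-zero (suc n) f f≡0 =
    cong₂ _+_ (sumTo-zero n f (λ i i≤n → f≡0 i (ℕₚ.m≤n⇒m≤1+n i≤n))) (f≡0 (suc n) ℕₚ.≤-refl)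

  sumTo-distrib-+ : ∀ n (f g : ℕ → ℤ) → sumTo n (λ i → f i + g i) ≡ sumTo n f + sumTo n g
  sumTo-distrib-+ zero    f g = refl
  sumTo-distrib-+ (suc n) f g =
    trans (cong (_+ (f (suc n) + g (suc n))) (sumTo-distrib-+ n f g))
          (interchange (sumTo n f) (sumTo n g) (f (suc n)) (g (suc n)))
    where
    interchange : ∀ a b c d → (a + b) + (c + d) ≡ (a + c) + (b + d)
    interchange = solve-∀

  sumTo-*ˡ : ∀ n c (f : ℕ → ℤ) → sumTo n (λ i → c * f i) ≡ c * sumTo n f
  sumTo-*ˡ zero    c f = refl
  sumTo-*ˡ (suc n) c f =
    trans (cong (_+ c * f (suc n)) (sumTo-*ˡ n c f)) (sym (ℤₚ.*-distribˡ-+ c (sumTo n f) (f (suc n))))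

  sumTo-*ʳ : ∀ n c (f : ℕ → ℤ) → sumTo n (λ i → f i * c) ≡ sumTo n f * c
  sumTo-*ʳ n c f =
    trans (sumTo-cong n (λ i _ → ℤₚ.*-comm (f i) c)) (trans (sumTo-*ˡ n c f) (ℤₚ.*-comm c (sumTo n f)))

  sumTo-suc-head : ∀ n (f : ℕ → ℤ) → sumTo (suc n) f ≡ f 0 + sumTo n (λ i → f (suc i))
  sumTo-suc-head zero    f = refl
  sumTo-suc-head (suc n) f =
    trans (cong (_+ f (suc (suc n))) (sumTo-suc-head n f)) (ℤₚ.+-assoc (f 0) _ _)

  sumTo-reverse : ∀ n (f : ℕ → ℤ) → sumTo n f ≡ sumTo n (λ i → f (n ∸ i))
  sumTo-reverse zero    f = refl
  sumTo-reverse (suc n) f = begin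
    sumTo n f + f (suc n)                  ≡⟨ ℤₚ.+-comm (sumTo n f) (f (suc n)) ⟩
    f (suc n) + sumTo n f                  ≡⟨ cong (_+_ (f (suc n))) (sumTo-reverse n f) ⟩
    f (suc n) + sumTo n (λ i → f (n ∸ i))  ≡⟨ sym (sumTo-suc-head n (λ i → f (suc n ∸ i))) ⟩
    sumTo (suc n) (λ i → f (suc n ∸ i))    ∎

  sumTo-swap : ∀ n m (f : ℕ → ℕ → ℤ) →
    sumTo n (λ i → sumTo m (f i)) ≡ sumTo m (λ j → sumTo n (λ i → f i j))
  sumTo-swap zero    m f = refl
  sumTo-swap (suc n) m f =
    trans (cong (_+ sumTo m (f (suc n))) (sumTo-swap n m f)) (sym (sumTo-distrib-+ m _ (f (suc n))))

  sumTo-vanishing : ∀ {j n} (f : ℕ → ℤ) → j ≤ n → (∀ i → j < i → f i ≡ + 0) → sumTo n f ≡ sumTo j f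
  sumTo-vanishing {j} {n} f j≤n f≡0 =
    trans (cong (λ m → sumTo m f) (sym (ℕₚ.m+[n∸m]≡n j≤n))) (extend (n ∸ j))
    where
    extend : ∀ d → sumTo (j ℕ.+ d) f ≡ sumTo j f
    extend zero    = cong (λ m → sumTo m f) (ℕₚ.+-identityʳ j)
    extend (suc d) = begin
      sumTo (j ℕ.+ suc d) f                  ≡⟨ cong (λ m → sumTo m f) (ℕₚ.+-suc j d) ⟩
      sumTo (j ℕ.+ d) f + f (suc (j ℕ.+ d))  ≡⟨ cong₂ _+_ (extend d) (f≡0 _ (s≤s (ℕₚ.m≤m+n j d))) ⟩
      sumTo j f + + 0                        ≡⟨ ℤₚ.+-identityʳ (sumTo j f) ⟩
      sumTo j f                              ∎

  isEven-suc-suc : ∀ a → isEven (suc (suc a)) ≡ isEven a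
  isEven-suc-suc a = cong (ℕ._≡ᵇ 0) (trans (cong (ℕ._% 2) (ℕₚ.+-comm 2 a)) ([m+n]%n≡m%n a 2))

  isEven-double : ∀ j → isEven (2 ℕ.* j) ≡ true
  isEven-double zero    = refl
  isEven-double (suc j) =
    trans (cong isEven (ℕₚ.*-suc 2 j)) (trans (isEven-suc-suc (2 ℕ.* j)) (isEven-double j))

  isEven-suc-double : ∀ j → isEven (suc (2 ℕ.* j)) ≡ false
  isEven-suc-double zero    = refl
  isEven-suc-double (suc j) =
    trans (cong (isEven ∘ suc) (ℕₚ.*-suc 2 j)) (trans (isEven-suc-suc (suc (2 ℕ.* j))) (isEven-suc-double j))

  isEven-double∸ : ∀ j a → a ≤ 2 ℕ.* j → isEven (2 ℕ.* j ∸ a) ≡ isEven a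
  isEven-double∸ j       zero          _  = isEven-double j
  isEven-double∸ zero    (suc a)       ()
  isEven-double∸ (suc j) (suc zero)    _  =
    trans (cong (λ m → isEven (m ∸ 1)) (ℕₚ.*-suc 2 j)) (isEven-suc-double j)
  isEven-double∸ (suc j) (suc (suc a)) a≤ =
    trans (cong (λ m → isEven (m ∸ suc (suc a))) (ℕₚ.*-suc 2 j))
          (trans (isEven-double∸ j a (ℕₚ.≤-pred (ℕₚ.≤-pred (subst (suc (suc a) ≤_) (ℕₚ.*-suc 2 j) a≤))))
                 (sym (isEven-suc-suc a)))

  sign-suc-suc : ∀ e → sign (suc (suc e)) ≡ sign e
  sign-suc-suc e = cong (if_then + 1 else - (+ 1)) (isEven-suc-suc e)

  sign-suc : ∀ e → sign (suc e) ≡ - sign e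
  sign-suc zero    = refl
  sign-suc (suc e) = trans (sign-suc-suc e) (trans (sym (ℤₚ.neg-involutive (sign e))) (cong -_ (sym (sign-suc e))))

  sign-+ : ∀ a b → sign (a ℕ.+ b) ≡ sign a * sign b
  sign-+ zero    b = sym (ℤₚ.*-identityˡ (sign b))
  sign-+ (suc a) b = begin
    sign (suc (a ℕ.+ b))   ≡⟨ sign-suc (a ℕ.+ b) ⟩
    - sign (a ℕ.+ b)       ≡⟨ cong -_ (sign-+ a b) ⟩
    - (sign a * sign b)    ≡⟨ ℤₚ.neg-distribˡ-* (sign a) (sign b) ⟩
    - sign a * sign b      ≡⟨ cong (_* sign b) (sym (sign-suc a)) ⟩
    sign (suc a) * sign b  ∎

  sign-split : ∀ {m n} p j → m ≤ n → sign (n ℕ.+ p ℕ.+ j) ≡ sign (m ℕ.+ j) * sign (n ∸ m ℕ.+ p)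
  sign-split {m} {n} p j m≤n = trans (cong sign exponents) (sign-+ (m ℕ.+ j) (n ∸ m ℕ.+ p))
    where
    rearrange : ∀ a b c d → a ℕ.+ b ℕ.+ c ℕ.+ d ≡ a ℕ.+ d ℕ.+ (b ℕ.+ c)
    rearrange = ℕ-Solver.solve-∀
    exponents : n ℕ.+ p ℕ.+ j ≡ m ℕ.+ j ℕ.+ (n ∸ m ℕ.+ p)
    exponents = trans (cong (λ x → x ℕ.+ p ℕ.+ j) (sym (ℕₚ.m+[n∸m]≡n m≤n))) (rearrange m (n ∸ m) p j)

  -- Pascal's recursion, so that binomial coefficients reduce by evaluation.
  binom : ℕ → ℕ → ℕ
  binom _       zero    = 1
  binom zero    (suc k) = 0
  binom (suc n) (suc k) = binom n k ℕ.+ binom n (suc k)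

  binom-vanish : ∀ {n k} → n < k → binom n k ≡ 0
  binom-vanish {zero}  {suc k} _         = refl
  binom-vanish {suc n} {suc k} (s≤s n<k) = cong₂ ℕ._+_ (binom-vanish n<k) (binom-vanish (ℕₚ.m<n⇒m<1+n n<k))

  binom≡C : ∀ n k → binom n k ≡ n C k
  binom≡C zero    zero    = refl
  binom≡C (suc n) zero    = refl
  binom≡C zero    (suc k) = sym (k>n⇒nCk≡0 {0} {suc k} (s≤s z≤n))
  binom≡C (suc n) (suc k) =
    trans (cong₂ ℕ._+_ (binom≡C n k) (binom≡C n (suc k))) (nCk+nC[k+1]≡[n+1]C[k+1] n k)

  -- the coefficient of X ^ i in (2 + X) ^ j
  binom₂ : ℕ → ℕ → ℕ
  binom₂ j i = binom j i ℕ.* 2 ^ (j ∸ i)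

  binom₂-zero : ∀ j → binom₂ (suc j) 0 ≡ 2 ℕ.* binom₂ j 0
  binom₂-zero j = trans (ℕₚ.*-identityˡ (2 ^ suc j)) (cong (2 ℕ.*_) (sym (ℕₚ.*-identityˡ (2 ^ j))))

  binom₂-suc : ∀ j i → binom₂ (suc j) (suc i) ≡ binom₂ j i ℕ.+ 2 ℕ.* binom₂ j (suc i)
  binom₂-suc j i =
    trans (ℕₚ.*-distribʳ-+ (2 ^ (j ∸ i)) (binom j i) (binom j (suc i)))
          (cong (binom₂ j i ℕ.+_) (halve j i (binom j (suc i)) (λ j≤i → binom-vanish (s≤s j≤i))))
    where
    halve : ∀ j i c → (j ≤ i → c ≡ 0) → c ℕ.* 2 ^ (j ∸ i) ≡ 2 ℕ.* (c ℕ.* 2 ^ (j ∸ suc i))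
    halve zero    i       c c≡0 rewrite c≡0 z≤n = refl
    halve (suc j) zero    c _   =
      trans (sym (ℕₚ.*-assoc c 2 (2 ^ j))) (trans (cong (ℕ._* 2 ^ j) (ℕₚ.*-comm c 2)) (ℕₚ.*-assoc 2 c (2 ^ j)))
    halve (suc j) (suc i) c c≡0 = halve j i c (c≡0 ∘ s≤s)

  binom₂-chain : ∀ {m j i} → i ≤ j → j ≤ m → 2 ^ (m ∸ i) ℕ.* (m C j) ℕ.* (j C i) ≡ binom₂ m j ℕ.* binom₂ j i
  binom₂-chain {m} {j} {i} i≤j j≤m = begin
    2 ^ (m ∸ i) ℕ.* (m C j) ℕ.* (j C i)
      ≡⟨ cong₂ (λ x y → 2 ^ (m ∸ i) ℕ.* x ℕ.* y) (sym (binom≡C m j)) (sym (binom≡C j i)) ⟩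
    2 ^ (m ∸ i) ℕ.* binom m j ℕ.* binom j i
      ≡⟨ cong (λ x → x ℕ.* binom m j ℕ.* binom j i)
              (trans (cong (2 ^_) split-exponent) (ℕₚ.^-distribˡ-+-* 2 (m ∸ j) (j ∸ i))) ⟩
    2 ^ (m ∸ j) ℕ.* 2 ^ (j ∸ i) ℕ.* binom m j ℕ.* binom j i
      ≡⟨ rearrange (2 ^ (m ∸ j)) (2 ^ (j ∸ i)) (binom m j) (binom j i) ⟩
    binom₂ m j ℕ.* binom₂ j i ∎
    where
    split-exponent : m ∸ i ≡ m ∸ j ℕ.+ (j ∸ i)
    split-exponent = trans (cong (_∸ i) (sym (ℕₚ.m∸n+n≡m j≤m))) (ℕₚ.+-∸-assoc (m ∸ j) i≤j)
    rearrange : ∀ u v x y → u ℕ.* v ℕ.* x ℕ.* y ≡ x ℕ.* u ℕ.* (y ℕ.* v)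
    rearrange = ℕ-Solver.solve-∀

  -- Formal power series over ℤ in a variable X, as coefficient sequences.
  Seq : Set
  Seq = ℕ → ℤ

  δ : Seq
  δ zero    = + 1
  δ (suc _) = + 0

  shift : Seq → Seq
  shift g zero    = + 0
  shift g (suc n) = g n

  -- multiplication by α + X
  mulLinear : ℤ → Seq → Seq
  mulLinear α g zero    = α * g zero
  mulLinear α g (suc n) = α * g (suc n) + g n

  mulLinearPow : ℤ → ℕ → Seq → Seq
  mulLinearPow α r g = fold g (mulLinear α) r

  _⊛_ : Seq → Seq → Seq
  (a ⊛ b) n = sumTo n (λ i → a i * b (n ∸ i))

  Linear : (Seq → Seq) → Set
  Linear F = ∀ m (c : ℕ → ℤ) (h : ℕ → Seq) n →
    F (λ q → sumTo m (λ j → c j * h j q)) n ≡ sumTo m (λ j → c j * F (h j) n)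

  shift≡+mulLinear-1ℤ : ∀ g p → shift g p ≡ g p + mulLinear -1ℤ g p
  shift≡+mulLinear-1ℤ g zero    = sym (trans (cong (_+_ (g 0)) (ℤₚ.-1*i≡-i (g 0))) (ℤₚ.+-inverseʳ (g 0)))
  shift≡+mulLinear-1ℤ g (suc p) =
    sym (trans (cong (λ z → g (suc p) + (z + g p)) (ℤₚ.-1*i≡-i (g (suc p)))) (cancel (g (suc p)) (g p)))
    where
    cancel : ∀ a b → a + (- a + b) ≡ b
    cancel = solve-∀

  mulLinear-cong : ∀ α {g h} → g ≗ h → mulLinear α g ≗ mulLinear α h
  mulLinear-cong α g≗h zero    = cong (α *_) (g≗h zero)
  mulLinear-cong α g≗h (suc n) = cong₂ (λ x y → α * x + y) (g≗h (suc n)) (g≗h n)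

  mulLinear-linear : ∀ α → Linear (mulLinear α)
  mulLinear-linear α m c h zero =
    trans (sym (sumTo-*ˡ m α _)) (sumTo-cong m (λ j _ → left-comm α (c j) (h j zero)))
    where
    left-comm : ∀ a b x → a * (b * x) ≡ b * (a * x)
    left-comm = solve-∀
  mulLinear-linear α m c h (suc n) = begin
    α * sumTo m (λ j → c j * h j (suc n)) + sumTo m (λ j → c j * h j n)
      ≡⟨ cong (_+ sumTo m (λ j → c j * h j n)) (sym (sumTo-*ˡ m α _)) ⟩
    sumTo m (λ j → α * (c j * h j (suc n))) + sumTo m (λ j → c j * h j n)
      ≡⟨ sym (sumTo-distrib-+ m _ _) ⟩
    sumTo m (λ j → α * (c j * h j (suc n)) + c j * h j n)
      ≡⟨ sumTo-cong m (λ j _ → factor α (c j) (h j (suc n)) (h j n)) ⟩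
    sumTo m (λ j → c j * (α * h j (suc n) + h j n)) ∎
    where
    factor : ∀ a b x y → a * (b * x) + b * y ≡ b * (a * x + y)
    factor = solve-∀

  mulLinearPow-cong : ∀ α r {g h} → g ≗ h → mulLinearPow α r g ≗ mulLinearPow α r h
  mulLinearPow-cong α zero    g≗h = g≗h
  mulLinearPow-cong α (suc r) g≗h = mulLinear-cong α (mulLinearPow-cong α r g≗h)

  mulLinearPow-linear : ∀ α r → Linear (mulLinearPow α r)
  mulLinearPow-linear α zero    m c h n = refl
  mulLinearPow-linear α (suc r) m c h n =
    trans (mulLinear-cong α (mulLinearPow-linear α r m c h) n)
          (mulLinear-linear α m c (λ j → mulLinearPow α r (h j)) n)

  ⊛-cong : ∀ {a a′ b b′} → a ≗ a′ → b ≗ b′ → a ⊛ b ≗ a′ ⊛ b′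
  ⊛-cong a≗a′ b≗b′ n = sumTo-cong n (λ i _ → cong₂ _*_ (a≗a′ i) (b≗b′ (n ∸ i)))

  ⊛-comm : ∀ a b → a ⊛ b ≗ b ⊛ a
  ⊛-comm a b n = begin
    sumTo n (λ i → a i * b (n ∸ i))              ≡⟨ sumTo-reverse n _ ⟩
    sumTo n (λ i → a (n ∸ i) * b (n ∸ (n ∸ i)))
      ≡⟨ sumTo-cong n (λ i i≤n → trans (cong (λ j → a (n ∸ i) * b j) (ℕₚ.m∸[m∸n]≡n i≤n)) (ℤₚ.*-comm (a (n ∸ i)) (b i))) ⟩
    sumTo n (λ i → b i * a (n ∸ i))              ∎

  δ-⊛ : ∀ b → δ ⊛ b ≗ b
  δ-⊛ b zero    = ℤₚ.*-identityˡ (b 0)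
  δ-⊛ b (suc n) = begin
    (δ ⊛ b) (suc n)                                ≡⟨ sumTo-suc-head n _ ⟩
    + 1 * b (suc n) + sumTo n (λ i → + 0 * b (n ∸ i))
      ≡⟨ cong₂ _+_ (ℤₚ.*-identityˡ (b (suc n))) (sumTo-zero n _ (λ _ _ → refl)) ⟩
    b (suc n) + + 0                                ≡⟨ ℤₚ.+-identityʳ (b (suc n)) ⟩
    b (suc n)                                      ∎

  mulLinear-⊛ : ∀ α a b → mulLinear α a ⊛ b ≗ mulLinear α (a ⊛ b)
  mulLinear-⊛ α a b zero    = ℤₚ.*-assoc α (a 0) (b 0)
  mulLinear-⊛ α a b (suc n) = begin
    (mulLinear α a ⊛ b) (suc n)
      ≡⟨ sumTo-suc-head n _ ⟩
    α * a 0 * b (suc n) + sumTo n (λ i → (α * a (suc i) + a i) * b (n ∸ i))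
      ≡⟨ cong (_+_ (α * a 0 * b (suc n)))
              (trans (sumTo-cong n (λ i _ → ℤₚ.*-distribʳ-+ (b (n ∸ i)) (α * a (suc i)) (a i))) (sumTo-distrib-+ n _ _)) ⟩
    α * a 0 * b (suc n) + (sumTo n (λ i → α * a (suc i) * b (n ∸ i)) + (a ⊛ b) n)
      ≡⟨ cong (λ z → α * a 0 * b (suc n) + (z + (a ⊛ b) n))
              (trans (sumTo-cong n (λ i _ → ℤₚ.*-assoc α (a (suc i)) (b (n ∸ i)))) (sumTo-*ˡ n α _)) ⟩
    α * a 0 * b (suc n) + (α * tail + (a ⊛ b) n)
      ≡⟨ regroup α (a 0) (b (suc n)) tail ((a ⊛ b) n) ⟩
    α * (a 0 * b (suc n) + tail) + (a ⊛ b) n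
      ≡⟨ cong (λ z → α * z + (a ⊛ b) n) (sym (sumTo-suc-head n (λ i → a i * b (suc n ∸ i)))) ⟩
    mulLinear α (a ⊛ b) (suc n) ∎
    where
    tail = sumTo n (λ i → a (suc i) * b (n ∸ i))
    regroup : ∀ α x y t s → α * x * y + (α * t + s) ≡ α * (x * y + t) + s
    regroup = solve-∀

  ⊛-mulLinear : ∀ α a b → a ⊛ mulLinear α b ≗ mulLinear α (a ⊛ b)
  ⊛-mulLinear α a b n =
    trans (⊛-comm a (mulLinear α b) n) (trans (mulLinear-⊛ α b a n) (mulLinear-cong α (⊛-comm b a) n))

  ⊛-mulLinearPow : ∀ α r a b → a ⊛ mulLinearPow α r b ≗ mulLinearPow α r (a ⊛ b)
  ⊛-mulLinearPow α zero    a b n = refl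
  ⊛-mulLinearPow α (suc r) a b n =
    trans (⊛-mulLinear α a (mulLinearPow α r b) n) (mulLinear-cong α (⊛-mulLinearPow α r a b) n)

  record Recurrence (c : ℕ → ℤ) (X : ℕ → Seq) : Set where
    constructor recurrence
    field
      initial : X 0 ≗ δ
      step    : ∀ n p → X (suc n) p ≡ sumTo n (λ r → c r * mulLinearPow -1ℤ r (X (n ∸ r)) p)

  Recurrence-cong : ∀ {c c′ X} → (∀ r → c r ≡ c′ r) → Recurrence c X → Recurrence c′ X
  Recurrence-cong {c} {c′} {X} c≡c′ (recurrence X-zero X-suc) = recurrence X-zero λ n p →
    trans (X-suc n p) (sumTo-cong n (λ r _ → cong (_* mulLinearPow -1ℤ r (X (n ∸ r)) p) (c≡c′ r)))

  Recurrence-unique : ∀ {c X Y} → Recurrence c X → Recurrence c Y → ∀ n → X n ≗ Y n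
  Recurrence-unique {c} {X} {Y} (recurrence X-zero X-suc) (recurrence Y-zero Y-suc) n = agree n n ℕₚ.≤-refl
    where
    agree : ∀ n m → m ≤ n → X m ≗ Y m
    agree n       zero    _         p = trans (X-zero p) (sym (Y-zero p))
    agree (suc n) (suc m) (s≤s m≤n) p = begin
      X (suc m) p
        ≡⟨ X-suc m p ⟩
      sumTo m (λ r → c r * mulLinearPow -1ℤ r (X (m ∸ r)) p)
        ≡⟨ sumTo-cong m (λ r _ → cong (c r *_)
             (mulLinearPow-cong -1ℤ r (agree n (m ∸ r) (ℕₚ.≤-trans (ℕₚ.m∸n≤m m r) m≤n)) p)) ⟩
      sumTo m (λ r → c r * mulLinearPow -1ℤ r (Y (m ∸ r)) p)
        ≡⟨ sym (Y-suc m p) ⟩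
      Y (suc m) p ∎

  [2+X]^ : ℕ → Seq
  [2+X]^ j i = + binom₂ j i

  [1+X]^ : ℕ → Seq
  [1+X]^ a i = + binom a i

  [X-1]^ : ℕ → Seq
  [X-1]^ a p = sign (a ℕ.+ p) * + binom a p

  [2+X]^-zero : [2+X]^ 0 ≗ δ
  [2+X]^-zero zero    = refl
  [2+X]^-zero (suc i) = refl

  [2+X]^-suc : ∀ j → [2+X]^ (suc j) ≗ mulLinear (+ 2) ([2+X]^ j)
  [2+X]^-suc j zero    = trans (cong +_ (binom₂-zero j)) (ℤₚ.pos-* 2 (binom₂ j 0))
  [2+X]^-suc j (suc i) = begin
    + binom₂ (suc j) (suc i)                          ≡⟨ cong +_ (binom₂-suc j i) ⟩
    + (binom₂ j i ℕ.+ 2 ℕ.* binom₂ j (suc i))         ≡⟨ ℤₚ.pos-+ (binom₂ j i) _ ⟩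
    + binom₂ j i + + (2 ℕ.* binom₂ j (suc i))         ≡⟨ ℤₚ.+-comm (+ binom₂ j i) (+ (2 ℕ.* binom₂ j (suc i))) ⟩
    + (2 ℕ.* binom₂ j (suc i)) + + binom₂ j i         ≡⟨ cong (_+ + binom₂ j i) (ℤₚ.pos-* 2 (binom₂ j (suc i))) ⟩
    + 2 * + binom₂ j (suc i) + + binom₂ j i           ∎

  [1+X]^-zero : [1+X]^ 0 ≗ δ
  [1+X]^-zero zero    = refl
  [1+X]^-zero (suc i) = refl

  [1+X]^-suc : ∀ a → [1+X]^ (suc a) ≗ mulLinear (+ 1) ([1+X]^ a)
  [1+X]^-suc a zero    = refl
  [1+X]^-suc a (suc i) = begin
    + (binom a i ℕ.+ binom a (suc i))       ≡⟨ ℤₚ.pos-+ (binom a i) (binom a (suc i)) ⟩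
    + binom a i + + binom a (suc i)         ≡⟨ ℤₚ.+-comm (+ binom a i) (+ binom a (suc i)) ⟩
    + binom a (suc i) + + binom a i         ≡⟨ cong (_+ + binom a i) (sym (ℤₚ.*-identityˡ (+ binom a (suc i)))) ⟩
    + 1 * + binom a (suc i) + + binom a i   ∎

  [1+X]^-+ : ∀ r a → [1+X]^ (r ℕ.+ a) ≗ mulLinearPow (+ 1) r ([1+X]^ a)
  [1+X]^-+ zero    a i = refl
  [1+X]^-+ (suc r) a i = trans ([1+X]^-suc (r ℕ.+ a) i) (mulLinear-cong (+ 1) ([1+X]^-+ r a) i)

  mulLinearPow+1≗[1+X]^⊛ : ∀ r g → mulLinearPow (+ 1) r g ≗ [1+X]^ r ⊛ g
  mulLinearPow+1≗[1+X]^⊛ zero    g n = sym (trans (⊛-cong {b = g} [1+X]^-zero (λ _ → refl) n) (δ-⊛ g n))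
  mulLinearPow+1≗[1+X]^⊛ (suc r) g n = begin
    mulLinear (+ 1) (mulLinearPow (+ 1) r g) n   ≡⟨ mulLinear-cong (+ 1) (mulLinearPow+1≗[1+X]^⊛ r g) n ⟩
    mulLinear (+ 1) ([1+X]^ r ⊛ g) n             ≡⟨ sym (mulLinear-⊛ (+ 1) ([1+X]^ r) g n) ⟩
    (mulLinear (+ 1) ([1+X]^ r) ⊛ g) n           ≡⟨ ⊛-cong {b = g} (λ i → sym ([1+X]^-suc r i)) (λ _ → refl) n ⟩
    ([1+X]^ (suc r) ⊛ g) n                       ∎

  [X-1]^-suc : ∀ a → mulLinear -1ℤ ([X-1]^ a) ≗ [X-1]^ (suc a)
  [X-1]^-suc a zero    = begin
    -1ℤ * (sign (a ℕ.+ 0) * + 1)   ≡⟨ ℤₚ.-1*i≡-i _ ⟩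
    - (sign (a ℕ.+ 0) * + 1)       ≡⟨ ℤₚ.neg-distribˡ-* (sign (a ℕ.+ 0)) (+ 1) ⟩
    - sign (a ℕ.+ 0) * + 1         ≡⟨ cong (_* + 1) (sym (sign-suc (a ℕ.+ 0))) ⟩
    sign (suc a ℕ.+ 0) * + 1       ∎
  [X-1]^-suc a (suc p) = begin
    -1ℤ * (sign (a ℕ.+ suc p) * + binom a (suc p)) + sign (a ℕ.+ p) * + binom a p
      ≡⟨ cong (λ s → -1ℤ * (s * + binom a (suc p)) + sign (a ℕ.+ p) * + binom a p)
              (trans (cong sign (ℕₚ.+-suc a p)) (sign-suc (a ℕ.+ p))) ⟩
    -1ℤ * (- sign (a ℕ.+ p) * + binom a (suc p)) + sign (a ℕ.+ p) * + binom a p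
      ≡⟨ factor (sign (a ℕ.+ p)) (+ binom a p) (+ binom a (suc p)) ⟩
    sign (a ℕ.+ p) * (+ binom a p + + binom a (suc p))
      ≡⟨ cong₂ _*_ (sym (trans (cong (sign ∘ suc) (ℕₚ.+-suc a p)) (sign-suc-suc (a ℕ.+ p))))
                   (sym (ℤₚ.pos-+ (binom a p) (binom a (suc p)))) ⟩
    sign (suc a ℕ.+ suc p) * + binom (suc a) (suc p) ∎
    where
    factor : ∀ s x y → -1ℤ * (- s * y) + s * x ≡ s * (x + y)
    factor = solve-∀

  mulLinearPow-[X-1]^ : ∀ r a → mulLinearPow -1ℤ r ([X-1]^ a) ≗ [X-1]^ (r ℕ.+ a)
  mulLinearPow-[X-1]^ zero    a p = refl
  mulLinearPow-[X-1]^ (suc r) a p =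
    trans (mulLinear-cong -1ℤ (mulLinearPow-[X-1]^ r a) p) ([X-1]^-suc (r ℕ.+ a) p)

  -- the coefficient of y ^ j in (y - 2) ^ m
  binom₋₂ : ℕ → ℕ → ℤ
  binom₋₂ m j = sign (m ℕ.+ j) * + binom₂ m j

  binom₋₂-zero : ∀ m → binom₋₂ (suc m) 0 ≡ - (+ 2) * binom₋₂ m 0
  binom₋₂-zero m = begin
    sign (suc m ℕ.+ 0) * + binom₂ (suc m) 0
      ≡⟨ cong₂ _*_ (sign-suc (m ℕ.+ 0)) (trans (cong +_ (binom₂-zero m)) (ℤₚ.pos-* 2 (binom₂ m 0))) ⟩
    - sign (m ℕ.+ 0) * (+ 2 * + binom₂ m 0)
      ≡⟨ swap (sign (m ℕ.+ 0)) (+ 2) (+ binom₂ m 0) ⟩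
    - (+ 2) * binom₋₂ m 0 ∎
    where
    swap : ∀ s t x → - s * (t * x) ≡ - t * (s * x)
    swap = solve-∀

  binom₋₂-suc : ∀ m j → binom₋₂ (suc m) (suc j) ≡ binom₋₂ m j + - (+ 2) * binom₋₂ m (suc j)
  binom₋₂-suc m j = begin
    sign (suc m ℕ.+ suc j) * + binom₂ (suc m) (suc j)
      ≡⟨ cong₂ _*_ (trans (cong (sign ∘ suc) (ℕₚ.+-suc m j)) (sign-suc-suc (m ℕ.+ j))) (cong +_ (binom₂-suc m j)) ⟩
    s * + (binom₂ m j ℕ.+ 2 ℕ.* binom₂ m (suc j))
      ≡⟨ cong (s *_) (trans (ℤₚ.pos-+ (binom₂ m j) _) (cong (_+_ (+ binom₂ m j)) (ℤₚ.pos-* 2 (binom₂ m (suc j))))) ⟩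
    s * (+ binom₂ m j + + 2 * + binom₂ m (suc j))
      ≡⟨ expand s (+ 2) (+ binom₂ m j) (+ binom₂ m (suc j)) ⟩
    binom₋₂ m j + - (+ 2) * (- s * + binom₂ m (suc j))
      ≡⟨ cong (λ t → binom₋₂ m j + - (+ 2) * (t * + binom₂ m (suc j)))
              (sym (trans (cong sign (ℕₚ.+-suc m j)) (sign-suc (m ℕ.+ j)))) ⟩
    binom₋₂ m j + - (+ 2) * binom₋₂ m (suc j) ∎
    where
    s = sign (m ℕ.+ j)
    expand : ∀ s t x y → s * (x + t * y) ≡ s * x + - t * (- s * y)
    expand = solve-∀

  binom₋₂-vanish : ∀ m → binom₋₂ m (suc m) ≡ + 0
  binom₋₂-vanish m = trans (cong (λ b → sign (m ℕ.+ suc m) * + (b ℕ.* 2 ^ (m ∸ suc m))) (binom-vanish (ℕₚ.n<1+n m)))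
    (ℤₚ.*-zeroʳ (sign (m ℕ.+ suc m)))

  -- (2 + X)(1 + X) ^ k = 2 + Σ_r ℓ k r X ^ (r + 1)
  ℓ : ℕ → ℕ → ℤ
  ℓ k r = + binom k r + + 2 * + binom k (suc r)

  module Formula (k : ℕ) where

    P : Seq
    P = mulLinear (+ 2) ([1+X]^ k)

    mulP : Seq → Seq
    mulP g = mulLinear (+ 2) (mulLinearPow (+ 1) k g)

    P^ : ℕ → Seq
    P^ j = [2+X]^ j ⊛ [1+X]^ (k ℕ.* j)

    mulP-2 : Seq → Seq
    mulP-2 g n = mulP g n - + 2 * g n

    [P-2]^ : ℕ → Seq
    [P-2]^ m n = sumTo m (λ j → binom₋₂ m j * P^ j n)

    closedForm : ℕ → Seq
    closedForm n p = sumTo n (λ m → [P-2]^ m n * [X-1]^ (n ∸ m) p)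

    mulP-linear : Linear mulP
    mulP-linear m c h n =
      trans (mulLinear-cong (+ 2) (mulLinearPow-linear (+ 1) k m c h) n)
            (mulLinear-linear (+ 2) m c (λ j → mulLinearPow (+ 1) k (h j)) n)

    mulP≗P⊛ : ∀ g → mulP g ≗ P ⊛ g
    mulP≗P⊛ g n =
      trans (mulLinear-cong (+ 2) (mulLinearPow+1≗[1+X]^⊛ k g) n) (sym (mulLinear-⊛ (+ 2) ([1+X]^ k) g n))

    P-suc : ∀ r → P (suc r) ≡ ℓ k r
    P-suc r = ℤₚ.+-comm (+ 2 * + binom k (suc r)) (+ binom k r)

    P^-zero : P^ 0 ≗ δ
    P^-zero n = trans (⊛-cong [2+X]^-zero (λ i → trans (cong (λ a → [1+X]^ a i) (ℕₚ.*-zeroʳ k)) ([1+X]^-zero i)) n)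
                      (δ-⊛ δ n)

    P^-suc : ∀ j → P^ (suc j) ≗ mulP (P^ j)
    P^-suc j n = begin
      ([2+X]^ (suc j) ⊛ [1+X]^ (k ℕ.* suc j)) n
        ≡⟨ ⊛-cong ([2+X]^-suc j) (λ i → trans (cong (λ a → [1+X]^ a i) (ℕₚ.*-suc k j)) ([1+X]^-+ k (k ℕ.* j) i)) n ⟩
      (mulLinear (+ 2) ([2+X]^ j) ⊛ mulLinearPow (+ 1) k ([1+X]^ (k ℕ.* j))) n
        ≡⟨ mulLinear-⊛ (+ 2) ([2+X]^ j) (mulLinearPow (+ 1) k ([1+X]^ (k ℕ.* j))) n ⟩
      mulLinear (+ 2) ([2+X]^ j ⊛ mulLinearPow (+ 1) k ([1+X]^ (k ℕ.* j))) n
        ≡⟨ mulLinear-cong (+ 2) (⊛-mulLinearPow (+ 1) k ([2+X]^ j) ([1+X]^ (k ℕ.* j))) n ⟩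
      mulP (P^ j) n ∎

    mulP-2-zero : ∀ g → mulP-2 g 0 ≡ + 0
    mulP-2-zero g = trans (cong (_- + 2 * g 0) (mulP≗P⊛ g 0)) (ℤₚ.+-inverseʳ (+ 2 * g 0))

    mulP-2-suc : ∀ g n → mulP-2 g (suc n) ≡ sumTo n (λ r → ℓ k r * g (n ∸ r))
    mulP-2-suc g n = begin
      mulP g (suc n) - + 2 * g (suc n)
        ≡⟨ cong (_- + 2 * g (suc n)) (trans (mulP≗P⊛ g (suc n)) (sumTo-suc-head n _)) ⟩
      (+ 2 * g (suc n) + sumTo n (λ r → P (suc r) * g (n ∸ r))) - + 2 * g (suc n)
        ≡⟨ cancel (+ 2 * g (suc n)) _ ⟩
      sumTo n (λ r → P (suc r) * g (n ∸ r))
        ≡⟨ sumTo-cong n (λ r _ → cong (_* g (n ∸ r)) (P-suc r)) ⟩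
      sumTo n (λ r → ℓ k r * g (n ∸ r)) ∎
      where
      cancel : ∀ a b → (a + b) - a ≡ b
      cancel = solve-∀

    [P-2]^-zero : [P-2]^ 0 ≗ δ
    [P-2]^-zero n = trans (ℤₚ.*-identityˡ (P^ 0 n)) (P^-zero n)

    [P-2]^-suc : ∀ m → [P-2]^ (suc m) ≗ mulP-2 ([P-2]^ m)
    [P-2]^-suc m n = begin
      [P-2]^ (suc m) n
        ≡⟨ sumTo-suc-head m (λ j → binom₋₂ (suc m) j * P^ j n) ⟩
      binom₋₂ (suc m) 0 * P^ 0 n + sumTo m (λ j → binom₋₂ (suc m) (suc j) * P^ (suc j) n)
        ≡⟨ cong₂ _+_ (cong (_* P^ 0 n) (binom₋₂-zero m))
                     (trans (sumTo-cong m (λ j _ → trans (cong (_* P^ (suc j) n) (binom₋₂-suc m j))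
                                                          (ℤₚ.*-distribʳ-+ (P^ (suc j) n) (binom₋₂ m j) _)))
                            (sumTo-distrib-+ m _ _)) ⟩
      term 0 + (raised + sumTo m (λ j → term (suc j)))
        ≡⟨ exchange (term 0) raised _ ⟩
      raised + (term 0 + sumTo m (λ j → term (suc j)))
        ≡⟨ cong (_+_ raised) (sym (sumTo-suc-head m term)) ⟩
      raised + sumTo (suc m) term
        ≡⟨ cong₂ _+_ raised≡mulP scaled ⟩
      mulP ([P-2]^ m) n - + 2 * [P-2]^ m n ∎
      where
      raised = sumTo m (λ j → binom₋₂ m j * P^ (suc j) n)
      exchange : ∀ a b c → a + (b + c) ≡ b + (a + c)
      exchange = solve-∀
      raised≡mulP : raised ≡ mulP ([P-2]^ m) n
      raised≡mulP = trans (sumTo-cong m (λ j _ → cong (binom₋₂ m j *_) (P^-suc j n)))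
                          (sym (mulP-linear m (binom₋₂ m) P^ n))
      term : ℕ → ℤ
      term j = - (+ 2) * binom₋₂ m j * P^ j n
      scaled : sumTo (suc m) term ≡ - (+ 2 * [P-2]^ m n)
      scaled = begin
        sumTo m term + term (suc m)
          ≡⟨ cong (_+_ (sumTo m term))
                  (trans (cong (λ c → - (+ 2) * c * P^ (suc m) n) (binom₋₂-vanish m)) (annihilate (P^ (suc m) n))) ⟩
        sumTo m term + + 0
          ≡⟨ ℤₚ.+-identityʳ (sumTo m term) ⟩
        sumTo m term
          ≡⟨ trans (sumTo-cong m (λ j _ → ℤₚ.*-assoc (- (+ 2)) (binom₋₂ m j) (P^ j n))) (sumTo-*ˡ m (- (+ 2)) _) ⟩
        - (+ 2) * [P-2]^ m n
          ≡⟨ sym (ℤₚ.neg-distribˡ-* (+ 2) ([P-2]^ m n)) ⟩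
        - (+ 2 * [P-2]^ m n) ∎
        where
        annihilate : ∀ x → - (+ 2) * + 0 * x ≡ + 0
        annihilate = solve-∀

    [P-2]^-vanish : ∀ {m n} → n < m → [P-2]^ m n ≡ + 0
    [P-2]^-vanish {suc m} {zero}  _         = trans ([P-2]^-suc m 0) (mulP-2-zero ([P-2]^ m))
    [P-2]^-vanish {suc m} {suc n} (s≤s n<m) = begin
      [P-2]^ (suc m) (suc n)
        ≡⟨ trans ([P-2]^-suc m (suc n)) (mulP-2-suc ([P-2]^ m) n) ⟩
      sumTo n (λ r → ℓ k r * [P-2]^ m (n ∸ r))
        ≡⟨ sumTo-zero n _ (λ r _ → trans (cong (ℓ k r *_) ([P-2]^-vanish (ℕₚ.≤-<-trans (ℕₚ.m∸n≤m n r) n<m)))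
                                         (ℤₚ.*-zeroʳ (ℓ k r))) ⟩
      + 0 ∎

    closedForm-zero : closedForm 0 ≗ δ
    closedForm-zero zero    = refl
    closedForm-zero (suc p) =
      trans (cong ([P-2]^ 0 0 *_) (ℤₚ.*-zeroʳ (sign (suc p)))) (ℤₚ.*-zeroʳ ([P-2]^ 0 0))

    mulLinearPow-closedForm : ∀ {n} r → r ≤ n → ∀ p →
      mulLinearPow -1ℤ r (closedForm (n ∸ r)) p ≡ sumTo n (λ m → [P-2]^ m (n ∸ r) * [X-1]^ (n ∸ m) p)
    mulLinearPow-closedForm {n} r r≤n p = begin
      mulLinearPow -1ℤ r (closedForm (n ∸ r)) p
        ≡⟨ mulLinearPow-linear -1ℤ r (n ∸ r) (λ m → [P-2]^ m (n ∸ r)) (λ m → [X-1]^ (n ∸ r ∸ m)) p ⟩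
      sumTo (n ∸ r) (λ m → [P-2]^ m (n ∸ r) * mulLinearPow -1ℤ r ([X-1]^ (n ∸ r ∸ m)) p)
        ≡⟨ sumTo-cong (n ∸ r) (λ m m≤ → cong ([P-2]^ m (n ∸ r) *_)
             (trans (mulLinearPow-[X-1]^ r (n ∸ r ∸ m) p) (cong (λ a → [X-1]^ a p) (exponent m m≤)))) ⟩
      sumTo (n ∸ r) (λ m → [P-2]^ m (n ∸ r) * [X-1]^ (n ∸ m) p)
        ≡⟨ sym (sumTo-vanishing _ (ℕₚ.m∸n≤m n r) (λ m n∸r<m →
             trans (cong (_* [X-1]^ (n ∸ m) p) ([P-2]^-vanish n∸r<m)) (ℤₚ.*-zeroˡ ([X-1]^ (n ∸ m) p)))) ⟩
      sumTo n (λ m → [P-2]^ m (n ∸ r) * [X-1]^ (n ∸ m) p) ∎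
      where
      exponent : ∀ m → m ≤ n ∸ r → r ℕ.+ (n ∸ r ∸ m) ≡ n ∸ m
      exponent m m≤ = trans (sym (ℕₚ.+-∸-assoc r m≤)) (cong (_∸ m) (ℕₚ.m+[n∸m]≡n r≤n))

    closedForm-suc : ∀ n p → closedForm (suc n) p ≡ sumTo n (λ r → ℓ k r * mulLinearPow -1ℤ r (closedForm (n ∸ r)) p)
    closedForm-suc n p = begin
      closedForm (suc n) p
        ≡⟨ sumTo-suc-head n (λ m → [P-2]^ m (suc n) * [X-1]^ (suc n ∸ m) p) ⟩
      [P-2]^ 0 (suc n) * [X-1]^ (suc n) p + sumTo n (λ m → [P-2]^ (suc m) (suc n) * [X-1]^ (n ∸ m) p)
        ≡⟨ cong (λ x → x * [X-1]^ (suc n) p + sumTo n (λ m → [P-2]^ (suc m) (suc n) * [X-1]^ (n ∸ m) p))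
                ([P-2]^-zero (suc n)) ⟩
      + 0 * [X-1]^ (suc n) p + sumTo n (λ m → [P-2]^ (suc m) (suc n) * [X-1]^ (n ∸ m) p)
        ≡⟨ ℤₚ.+-identityˡ _ ⟩
      sumTo n (λ m → [P-2]^ (suc m) (suc n) * [X-1]^ (n ∸ m) p)
        ≡⟨ sumTo-cong n (λ m _ → trans (cong (_* [X-1]^ (n ∸ m) p) (trans ([P-2]^-suc m (suc n)) (mulP-2-suc ([P-2]^ m) n)))
                                       (sym (sumTo-*ʳ n ([X-1]^ (n ∸ m) p) _))) ⟩
      sumTo n (λ m → sumTo n (λ r → ℓ k r * [P-2]^ m (n ∸ r) * [X-1]^ (n ∸ m) p))
        ≡⟨ sumTo-swap n n _ ⟩
      sumTo n (λ r → sumTo n (λ m → ℓ k r * [P-2]^ m (n ∸ r) * [X-1]^ (n ∸ m) p))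
        ≡⟨ sumTo-cong n (λ r _ → trans (sumTo-cong n (λ m _ → ℤₚ.*-assoc (ℓ k r) _ _)) (sumTo-*ˡ n (ℓ k r) _)) ⟩
      sumTo n (λ r → ℓ k r * sumTo n (λ m → [P-2]^ m (n ∸ r) * [X-1]^ (n ∸ m) p))
        ≡⟨ sumTo-cong n (λ r r≤n → cong (ℓ k r *_) (sym (mulLinearPow-closedForm r r≤n p))) ⟩
      sumTo n (λ r → ℓ k r * mulLinearPow -1ℤ r (closedForm (n ∸ r)) p) ∎

    closedForm-recurrence : Recurrence (ℓ k) closedForm
    closedForm-recurrence = recurrence closedForm-zero closedForm-suc

    formula-summand : ∀ {n p m j i} → i ≤ j → j ≤ m → m ≤ n →
      sign (n ℕ.+ p ℕ.+ j) * + (2 ^ (m ∸ i) ℕ.* (m C j) ℕ.* (j C i) ℕ.* ((k ℕ.* j) C (n ∸ i)) ℕ.* ((n ∸ m) C p))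
        ≡ binom₋₂ m j * ([2+X]^ j i * [1+X]^ (k ℕ.* j) (n ∸ i)) * [X-1]^ (n ∸ m) p
    formula-summand {n} {p} {m} {j} {i} i≤j j≤m m≤n = begin
      sign (n ℕ.+ p ℕ.+ j) * + (2 ^ (m ∸ i) ℕ.* (m C j) ℕ.* (j C i) ℕ.* ((k ℕ.* j) C (n ∸ i)) ℕ.* ((n ∸ m) C p))
        ≡⟨ cong₂ _*_ (sign-split p j m≤n)
                     (cong +_ (cong₂ ℕ._*_ (cong₂ ℕ._*_ (binom₂-chain i≤j j≤m) (sym (binom≡C (k ℕ.* j) (n ∸ i))))
                                           (sym (binom≡C (n ∸ m) p)))) ⟩
      sign (m ℕ.+ j) * sign (n ∸ m ℕ.+ p) * + (binom₂ m j ℕ.* binom₂ j i ℕ.* b ℕ.* c)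
        ≡⟨ cong (sign (m ℕ.+ j) * sign (n ∸ m ℕ.+ p) *_)
                (trans (ℤₚ.pos-* (binom₂ m j ℕ.* binom₂ j i ℕ.* b) c)
                       (cong (_* + c) (trans (ℤₚ.pos-* (binom₂ m j ℕ.* binom₂ j i) b)
                                             (cong (_* + b) (ℤₚ.pos-* (binom₂ m j) (binom₂ j i)))))) ⟩
      sign (m ℕ.+ j) * sign (n ∸ m ℕ.+ p) * (+ binom₂ m j * + binom₂ j i * + b * + c)
        ≡⟨ regroup (sign (m ℕ.+ j)) (sign (n ∸ m ℕ.+ p)) (+ binom₂ m j) (+ binom₂ j i) (+ b) (+ c) ⟩
      binom₋₂ m j * ([2+X]^ j i * [1+X]^ (k ℕ.* j) (n ∸ i)) * [X-1]^ (n ∸ m) p ∎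
      where
      b = binom (k ℕ.* j) (n ∸ i)
      c = binom (n ∸ m) p
      regroup : ∀ s t x y z w → s * t * (x * y * z * w) ≡ s * x * (y * z) * (t * w)
      regroup = solve-∀

    formula≡closedForm : ∀ n p → formula k n p ≡ closedForm n p
    formula≡closedForm n p =
      sumTo-cong n (λ m m≤n → trans (sumTo-cong m (λ j j≤m → inner m j j≤m m≤n)) (sumTo-*ʳ m ([X-1]^ (n ∸ m) p) _))
      where
      summand : ℕ → ℕ → ℕ → ℤ
      summand m j i = sign (n ℕ.+ p ℕ.+ j)
        * + (2 ^ (m ∸ i) ℕ.* (m C j) ℕ.* (j C i) ℕ.* ((k ℕ.* j) C (n ∸ i)) ℕ.* ((n ∸ m) C p))

      factorised : ℕ → ℕ → ℕ → ℤ
      factorised m j i = binom₋₂ m j * ([2+X]^ j i * [1+X]^ (k ℕ.* j) (n ∸ i)) * [X-1]^ (n ∸ m) p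

      inner : ∀ m j → j ≤ m → m ≤ n → sumTo j (summand m j) ≡ binom₋₂ m j * P^ j n * [X-1]^ (n ∸ m) p
      inner m j j≤m m≤n = begin
        sumTo j (summand m j)
          ≡⟨ sumTo-cong j (λ i i≤j → formula-summand i≤j j≤m m≤n) ⟩
        sumTo j (factorised m j)
          ≡⟨ sym (sumTo-vanishing (factorised m j) (ℕₚ.≤-trans j≤m m≤n) beyond-j) ⟩
        sumTo n (factorised m j)
          ≡⟨ sumTo-*ʳ n ([X-1]^ (n ∸ m) p) _ ⟩
        sumTo n (λ i → binom₋₂ m j * ([2+X]^ j i * [1+X]^ (k ℕ.* j) (n ∸ i))) * [X-1]^ (n ∸ m) p
          ≡⟨ cong (_* [X-1]^ (n ∸ m) p) (sumTo-*ˡ n (binom₋₂ m j) _) ⟩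
        binom₋₂ m j * P^ j n * [X-1]^ (n ∸ m) p ∎
        where
        beyond-j : ∀ i → j < i → factorised m j i ≡ + 0
        beyond-j i j<i = trans
          (cong (λ t → binom₋₂ m j * (+ (t ℕ.* 2 ^ (j ∸ i)) * [1+X]^ (k ℕ.* j) (n ∸ i)) * [X-1]^ (n ∸ m) p)
                (binom-vanish j<i))
          (annihilate (binom₋₂ m j) ([1+X]^ (k ℕ.* j) (n ∸ i)) ([X-1]^ (n ∸ m) p))
          where
          annihilate : ∀ a y v → a * (+ 0 * y) * v ≡ + 0
          annihilate = solve-∀

    Recurrence⇒formula : ∀ {X} → Recurrence (ℓ k) X → ∀ n p → X n p ≡ formula k n p
    Recurrence⇒formula rec n p =
      trans (Recurrence-unique rec closedForm-recurrence n p) (sym (formula≡closedForm n p))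


module WordCounts where

  open ClosedFormula
  open import Data.Integer using (-_; _+_; _*_; -1ℤ)
  import Data.Bool.Properties as Boolₚ
  open import Data.List using (List; []; _∷_; _++_; map; concatMap; length; filter; upTo)
  import Data.List.Properties as Listₚ
  open import Data.Sum using (inj₁; inj₂)
  open import Relation.Nullary using (does)
  open import Relation.Unary using (Decidable)

  sumList : {A : Set} → List A → (A → ℤ) → ℤ
  sumList []       f = + 0
  sumList (x ∷ xs) f = f x + sumList xs f

  module _ {A : Set} where

    sumList-cong : ∀ (xs : List A) {f g} → (∀ x → f x ≡ g x) → sumList xs f ≡ sumList xs g
    sumList-cong []       f≡g = refl
    sumList-cong (x ∷ xs) f≡g = cong₂ _+_ (f≡g x) (sumList-cong xs f≡g)

    sumList-zero : ∀ (xs : List A) f → (∀ x → f x ≡ + 0) → sumList xs f ≡ + 0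
    sumList-zero []       f f≡0 = refl
    sumList-zero (x ∷ xs) f f≡0 = cong₂ _+_ (f≡0 x) (sumList-zero xs f f≡0)

    sumList-distrib-+ : ∀ (xs : List A) f g → sumList xs (λ x → f x + g x) ≡ sumList xs f + sumList xs g
    sumList-distrib-+ []       f g = refl
    sumList-distrib-+ (x ∷ xs) f g =
      trans (cong (_+_ (f x + g x)) (sumList-distrib-+ xs f g)) (interchange (f x) (g x) (sumList xs f) (sumList xs g))
      where
      interchange : ∀ a b c d → (a + b) + (c + d) ≡ (a + c) + (b + d)
      interchange = solve-∀

    sumList-*ʳ : ∀ (xs : List A) f c → sumList xs (λ x → f x * c) ≡ sumList xs f * c
    sumList-*ʳ []       f c = sym (ℤₚ.*-zeroˡ c)
    sumList-*ʳ (x ∷ xs) f c =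
      trans (cong (_+_ (f x * c)) (sumList-*ʳ xs f c)) (sym (ℤₚ.*-distribʳ-+ c (f x) (sumList xs f)))

    sumList-sumTo : ∀ (xs : List A) n (f : A → ℕ → ℤ) →
      sumList xs (λ x → sumTo n (f x)) ≡ sumTo n (λ r → sumList xs (λ x → f x r))
    sumList-sumTo []       n f = sym (sumTo-zero n _ (λ _ _ → refl))
    sumList-sumTo (x ∷ xs) n f =
      trans (cong (_+_ (sumTo n (f x))) (sumList-sumTo xs n f)) (sym (sumTo-distrib-+ n (f x) (λ r → sumList xs (λ y → f y r))))

    sumList-++ : ∀ (xs ys : List A) f → sumList (xs ++ ys) f ≡ sumList xs f + sumList ys f
    sumList-++ []       ys f = sym (ℤₚ.+-identityˡ (sumList ys f))
    sumList-++ (x ∷ xs) ys f = trans (cong (_+_ (f x)) (sumList-++ xs ys f)) (sym (ℤₚ.+-assoc (f x) _ _))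

  sumList-map : ∀ {A B : Set} (g : A → B) xs f → sumList (map g xs) f ≡ sumList xs (f ∘ g)
  sumList-map g []       f = refl
  sumList-map g (x ∷ xs) f = cong (_+_ (f (g x))) (sumList-map g xs f)

  sumList-letters-suc : ∀ M f → sumList (letters (suc M)) f ≡ sumList (letters M) f + f (suc M)
  sumList-letters-suc M f = begin
    sumList (letters (suc M)) f                   ≡⟨ cong (λ xs → sumList (map suc xs) f) (sym (Listₚ.upTo-∷ʳ M)) ⟩
    sumList (map suc (upTo M ++ M ∷ [])) f        ≡⟨ cong (λ xs → sumList xs f) (Listₚ.map-++ suc (upTo M) (M ∷ [])) ⟩
    sumList (letters M ++ suc M ∷ []) f           ≡⟨ sumList-++ (letters M) (suc M ∷ []) f ⟩
    sumList (letters M) f + (f (suc M) + + 0)     ≡⟨ cong (_+_ (sumList (letters M) f)) (ℤₚ.+-identityʳ (f (suc M))) ⟩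
    sumList (letters M) f + f (suc M)             ∎

  sumList-letters-cong : ∀ M {f g} → (∀ b → b ≤ M → f b ≡ g b) → sumList (letters M) f ≡ sumList (letters M) g
  sumList-letters-cong zero    f≡g = refl
  sumList-letters-cong (suc M) {f} {g} f≡g = begin
    sumList (letters (suc M)) f        ≡⟨ sumList-letters-suc M f ⟩
    sumList (letters M) f + f (suc M)
      ≡⟨ cong₂ _+_ (sumList-letters-cong M (λ b b≤M → f≡g b (ℕₚ.m≤n⇒m≤1+n b≤M))) (f≡g (suc M) ℕₚ.≤-refl) ⟩
    sumList (letters M) g + g (suc M)  ≡⟨ sym (sumList-letters-suc M g) ⟩
    sumList (letters (suc M)) g        ∎

  sumList-letters-complement : ∀ M f → sumList (letters M) (λ b → f (suc M ∸ b)) ≡ sumList (letters M) f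
  sumList-letters-complement zero    f = refl
  sumList-letters-complement (suc M) f = begin
    sumList (letters (suc M)) (λ b → f (suc (suc M) ∸ b))
      ≡⟨ cong (λ xs → f (suc M) + sumList (map suc xs) (λ b → f (suc (suc M) ∸ b))) (sym (Listₚ.map-upTo suc M)) ⟩
    f (suc M) + sumList (map suc (letters M)) (λ b → f (suc (suc M) ∸ b))
      ≡⟨ cong (_+_ (f (suc M))) (trans (sumList-map suc (letters M) _) (sumList-letters-complement M f)) ⟩
    f (suc M) + sumList (letters M) f
      ≡⟨ trans (ℤₚ.+-comm (f (suc M)) _) (sym (sumList-letters-suc M f)) ⟩
    sumList (letters (suc M)) f ∎

  <ᵇ-true : ∀ {m n} → m < n → (m <ᵇ n) ≡ true
  <ᵇ-true {zero}  {suc n} _         = refl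
  <ᵇ-true {suc m} {suc n} (s≤s m<n) = <ᵇ-true m<n

  <ᵇ-false : ∀ {m n} → n ≤ m → (m <ᵇ n) ≡ false
  <ᵇ-false {m}     {zero}  _         = refl
  <ᵇ-false {suc m} {suc n} (s≤s n≤m) = <ᵇ-false n≤m

  <ᵇ-∸ : ∀ a b S → b ≤ S → (a <ᵇ S ∸ b) ≡ (a ℕ.+ b <ᵇ S)
  <ᵇ-∸ a zero    S       _         = cong (_<ᵇ S) (sym (ℕₚ.+-identityʳ a))
  <ᵇ-∸ a (suc b) (suc S) (s≤s b≤S) = trans (<ᵇ-∸ a b S b≤S) (cong (_<ᵇ suc S) (sym (ℕₚ.+-suc a b)))

  <ᵇ-complement : ∀ {a b S} → a ≤ S → b ≤ S → (a <ᵇ S ∸ b) ≡ (b <ᵇ S ∸ a)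
  <ᵇ-complement {a} {b} {S} a≤S b≤S =
    trans (<ᵇ-∸ a b S b≤S) (trans (cong (_<ᵇ S) (ℕₚ.+-comm a b)) (sym (<ᵇ-∸ b a S a≤S)))

  sumList-letters-below : ∀ M a f → a ≤ suc M →
    sumList (letters M) (λ b → if b <ᵇ a then f b else + 0) ≡ sumList (letters (a ∸ 1)) f
  sumList-letters-below zero    zero          f _ = refl
  sumList-letters-below zero    (suc zero)    f _ = refl
  sumList-letters-below zero    (suc (suc a)) f (s≤s ())
  sumList-letters-below (suc M) a             f a≤ with ℕₚ.m≤n⇒m<n∨m≡n a≤
  ... | inj₁ (s≤s a≤M) = begin
    sumList (letters (suc M)) (λ b → if b <ᵇ a then f b else + 0)
      ≡⟨ sumList-letters-suc M _ ⟩
    sumList (letters M) (λ b → if b <ᵇ a then f b else + 0) + (if suc M <ᵇ a then f (suc M) else + 0)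
      ≡⟨ cong₂ _+_ (sumList-letters-below M a f a≤M) (cong (if_then f (suc M) else + 0) (<ᵇ-false a≤M)) ⟩
    sumList (letters (a ∸ 1)) f + + 0
      ≡⟨ ℤₚ.+-identityʳ _ ⟩
    sumList (letters (a ∸ 1)) f ∎
  ... | inj₂ refl = begin
    sumList (letters (suc M)) (λ b → if b <ᵇ suc (suc M) then f b else + 0)
      ≡⟨ sumList-letters-cong (suc M) (λ b b≤ → cong (if_then f b else + 0) (<ᵇ-true (s≤s b≤))) ⟩
    sumList (letters (suc M)) f ∎

  length-filter-∷ : ∀ {A : Set} {P : A → Set} (P? : Decidable P) x xs →
    length (filter P? (x ∷ xs)) ≡ (if does (P? x) then 1 else 0) ℕ.+ length (filter P? xs)
  length-filter-∷ P? x xs with does (P? x)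
  ... | true  = refl
  ... | false = refl

  length-filter-cong : ∀ {A : Set} {P Q : A → Set} (P? : Decidable P) (Q? : Decidable Q) xs →
    (∀ x → does (P? x) ≡ does (Q? x)) → length (filter P? xs) ≡ length (filter Q? xs)
  length-filter-cong P? Q? []       P≡Q = refl
  length-filter-cong P? Q? (x ∷ xs) P≡Q = begin
    length (filter P? (x ∷ xs))                               ≡⟨ length-filter-∷ P? x xs ⟩
    (if does (P? x) then 1 else 0) ℕ.+ length (filter P? xs)
      ≡⟨ cong₂ (λ b l → (if b then 1 else 0) ℕ.+ l) (P≡Q x) (length-filter-cong P? Q? xs P≡Q) ⟩
    (if does (Q? x) then 1 else 0) ℕ.+ length (filter Q? xs)  ≡⟨ sym (length-filter-∷ Q? x xs) ⟩
    length (filter Q? (x ∷ xs))                               ∎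

  length-filter-map : ∀ {A B : Set} {P : B → Set} (P? : Decidable P) (f : A → B) xs →
    length (filter P? (map f xs)) ≡ length (filter (P? ∘ f) xs)
  length-filter-map P? f []       = refl
  length-filter-map P? f (x ∷ xs) = begin
    length (filter P? (f x ∷ map f xs))                                  ≡⟨ length-filter-∷ P? (f x) (map f xs) ⟩
    (if does (P? (f x)) then 1 else 0) ℕ.+ length (filter P? (map f xs))
      ≡⟨ cong ((if does (P? (f x)) then 1 else 0) ℕ.+_) (length-filter-map P? f xs) ⟩
    (if does (P? (f x)) then 1 else 0) ℕ.+ length (filter (P? ∘ f) xs)  ≡⟨ sym (length-filter-∷ (P? ∘ f) x xs) ⟩
    length (filter (P? ∘ f) (x ∷ xs))                                    ∎

  -- Σ_{x ∈ xs} X ^ st x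
  distribution : {A : Set} → (A → ℕ) → List A → Seq
  distribution st xs p = + length (filter (λ x → st x ℕ.≟ p) xs)

  module _ {A : Set} where

    distribution-cong : ∀ {st st′ : A → ℕ} xs → (∀ x → st x ≡ st′ x) → distribution st xs ≗ distribution st′ xs
    distribution-cong {st} {st′} xs st≡st′ p =
      cong +_ (length-filter-cong (λ x → st x ℕ.≟ p) (λ x → st′ x ℕ.≟ p) xs
                                  (λ x → cong (λ s → does (s ℕ.≟ p)) (st≡st′ x)))

    distribution-map : ∀ {B : Set} (st : B → ℕ) (f : A → B) xs → distribution st (map f xs) ≗ distribution (st ∘ f) xs
    distribution-map st f xs p = cong +_ (length-filter-map (λ y → st y ℕ.≟ p) f xs)

    distribution-concatMap : ∀ {B : Set} (st : B → ℕ) (f : A → List B) xs p →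
      distribution st (concatMap f xs) p ≡ sumList xs (λ x → distribution st (f x) p)
    distribution-concatMap st f []       p = refl
    distribution-concatMap st f (x ∷ xs) p = begin
      + length (filter P? (f x ++ concatMap f xs))
        ≡⟨ cong (+_ ∘ length) (Listₚ.filter-++ P? (f x) (concatMap f xs)) ⟩
      + length (filter P? (f x) ++ filter P? (concatMap f xs))
        ≡⟨ cong +_ (Listₚ.length-++ (filter P? (f x))) ⟩
      + (length (filter P? (f x)) ℕ.+ length (filter P? (concatMap f xs)))
        ≡⟨ ℤₚ.pos-+ (length (filter P? (f x))) _ ⟩
      distribution st (f x) p + distribution st (concatMap f xs) p
        ≡⟨ cong (_+_ (distribution st (f x) p)) (distribution-concatMap st f xs p) ⟩
      sumList (x ∷ xs) (λ y → distribution st (f y) p) ∎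
      where
      P? = λ y → st y ℕ.≟ p

    distribution-suc : ∀ (st : A → ℕ) xs → distribution (suc ∘ st) xs ≗ shift (distribution st xs)
    distribution-suc st xs zero    = cong +_ (never xs)
      where
      never : ∀ xs → length (filter (λ x → suc (st x) ℕ.≟ 0) xs) ≡ 0
      never []       = refl
      never (x ∷ xs) = never xs
    distribution-suc st xs (suc p) =
      cong +_ (length-filter-cong (λ x → suc (st x) ℕ.≟ suc p) (λ x → st x ℕ.≟ p) xs (λ _ → refl))

    distribution-[_] : ∀ (st : A → ℕ) x → st x ≡ 0 → distribution st (x ∷ []) ≗ δ
    distribution-[ st ] x st≡0 p =
      trans (cong +_ (length-filter-∷ (λ y → st y ℕ.≟ p) x []))
            (trans (cong (λ s → + ((if does (s ℕ.≟ p) then 1 else 0) ℕ.+ 0)) st≡0) (at-zero p))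
      where
      at-zero : ∀ p → + ((if does (0 ℕ.≟ p) then 1 else 0) ℕ.+ 0) ≡ δ p
      at-zero zero    = refl
      at-zero (suc p) = refl

  module AdjacentStatistic (N : ℕ) (cond : ℕ → ℕ → Bool) (st : List ℕ → ℕ)
    (st-[] : st [] ≡ 0) (st-[-] : ∀ a → st (a ∷ []) ≡ 0)
    (st-∷∷ : ∀ a b w → st (a ∷ b ∷ w) ≡ (if cond a b then 1 else 0) ℕ.+ st (b ∷ w)) where

    X : ℕ → Seq
    X n = distribution st (words N n)

    Xfrom : ℕ → ℕ → Seq
    Xfrom n a = distribution (st ∘ (a ∷_)) (words N n)

    chains : ℕ → ℕ → ℤ
    chains a zero    = + 1
    chains a (suc r) = sumList (letters N) (λ b → if cond a b then chains b r else + 0)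

    totalChains : ℕ → ℤ
    totalChains r = sumList (letters N) (λ a → chains a r)

    X-suc : ∀ n p → X (suc n) p ≡ sumList (letters N) (λ a → Xfrom n a p)
    X-suc n p = trans (distribution-concatMap st (λ a → map (a ∷_) (words N n)) (letters N) p)
                      (sumList-cong (letters N) (λ a → distribution-map st (a ∷_) (words N n) p))

    Xfrom-suc : ∀ n a p →
      Xfrom (suc n) a p ≡ sumList (letters N) (λ b → (if cond a b then shift (Xfrom n b) else Xfrom n b) p)
    Xfrom-suc n a p =
      trans (distribution-concatMap (st ∘ (a ∷_)) (λ b → map (b ∷_) (words N n)) (letters N) p)
            (sumList-cong (letters N) (λ b → trans (distribution-map (st ∘ (a ∷_)) (b ∷_) (words N n) p)
                                                   (trans (distribution-cong (words N n) (st-∷∷ a b) p) (indicator b (cond a b)))))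
      where
      indicator : ∀ b c → distribution (λ w → (if c then 1 else 0) ℕ.+ st (b ∷ w)) (words N n) p
                          ≡ (if c then shift (Xfrom n b) else Xfrom n b) p
      indicator b true  = distribution-suc (st ∘ (b ∷_)) (words N n) p
      indicator b false = refl

    -- Expand the factor X = 1 + (X − 1) contributed by each adjacent pair satisfying cond.
    Xfrom-chains : ∀ n a p → Xfrom n a p ≡ sumTo n (λ r → chains a r * mulLinearPow -1ℤ r (X (n ∸ r)) p)
    Xfrom-chains zero    a p = trans (distribution-[ st ∘ (a ∷_) ] [] (st-[-] a) p)
                                     (trans (sym (distribution-[ st ] [] st-[] p)) (sym (ℤₚ.*-identityˡ (X 0 p))))
    Xfrom-chains (suc n) a p = begin
      Xfrom (suc n) a p
        ≡⟨ trans (Xfrom-suc n a p) (sumList-cong (letters N) (λ b → split b (cond a b))) ⟩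
      sumList (letters N) (λ b → Xfrom n b p + (if cond a b then mulLinear -1ℤ (Xfrom n b) p else + 0))
        ≡⟨ sumList-distrib-+ (letters N) _ _ ⟩
      sumList (letters N) (λ b → Xfrom n b p) + sumList (letters N) (λ b → if cond a b then mulLinear -1ℤ (Xfrom n b) p else + 0)
        ≡⟨ cong₂ _+_ (trans (sym (X-suc n p)) (sym (ℤₚ.*-identityˡ (X (suc n) p)))) longer ⟩
      + 1 * X (suc n) p + sumTo n (λ r → chains a (suc r) * Y r)
        ≡⟨ sym (sumTo-suc-head n (λ r → chains a r * mulLinearPow -1ℤ r (X (suc n ∸ r)) p)) ⟩
      sumTo (suc n) (λ r → chains a r * mulLinearPow -1ℤ r (X (suc n ∸ r)) p) ∎
      where
      split : ∀ b c → (if c then shift (Xfrom n b) else Xfrom n b) p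
                      ≡ Xfrom n b p + (if c then mulLinear -1ℤ (Xfrom n b) p else + 0)
      split b true  = shift≡+mulLinear-1ℤ (Xfrom n b) p
      split b false = sym (ℤₚ.+-identityʳ (Xfrom n b p))

      Y : ℕ → ℤ
      Y r = mulLinearPow -1ℤ (suc r) (X (n ∸ r)) p

      first-step : ∀ b c → (if c then mulLinear -1ℤ (Xfrom n b) p else + 0)
                           ≡ sumTo n (λ r → (if c then chains b r else + 0) * Y r)
      first-step b true  = trans (mulLinear-cong -1ℤ (Xfrom-chains n b) p)
                                 (mulLinear-linear -1ℤ n (chains b) (λ r → mulLinearPow -1ℤ r (X (n ∸ r))) p)
      first-step b false = sym (sumTo-zero n _ (λ r _ → ℤₚ.*-zeroˡ (Y r)))

      longer : sumList (letters N) (λ b → if cond a b then mulLinear -1ℤ (Xfrom n b) p else + 0)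
               ≡ sumTo n (λ r → chains a (suc r) * Y r)
      longer = begin
        sumList (letters N) (λ b → if cond a b then mulLinear -1ℤ (Xfrom n b) p else + 0)
          ≡⟨ sumList-cong (letters N) (λ b → first-step b (cond a b)) ⟩
        sumList (letters N) (λ b → sumTo n (λ r → (if cond a b then chains b r else + 0) * Y r))
          ≡⟨ sumList-sumTo (letters N) n _ ⟩
        sumTo n (λ r → sumList (letters N) (λ b → (if cond a b then chains b r else + 0) * Y r))
          ≡⟨ sumTo-cong n (λ r _ → sumList-*ʳ (letters N) _ (Y r)) ⟩
        sumTo n (λ r → chains a (suc r) * Y r) ∎

    X-recurrence : Recurrence totalChains X
    X-recurrence = recurrence (distribution-[ st ] [] st-[]) λ n p → begin
      X (suc n) p
        ≡⟨ X-suc n p ⟩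
      sumList (letters N) (λ a → Xfrom n a p)
        ≡⟨ sumList-cong (letters N) (λ a → Xfrom-chains n a p) ⟩
      sumList (letters N) (λ a → sumTo n (λ r → chains a r * mulLinearPow -1ℤ r (X (n ∸ r)) p))
        ≡⟨ sumList-sumTo (letters N) n _ ⟩
      sumTo n (λ r → sumList (letters N) (λ a → chains a r * mulLinearPow -1ℤ r (X (n ∸ r)) p))
        ≡⟨ sumTo-cong n (λ r _ → sumList-*ʳ (letters N) (λ a → chains a r) _) ⟩
      sumTo n (λ r → totalChains r * mulLinearPow -1ℤ r (X (n ∸ r)) p) ∎

  desCond : ℕ → ℕ → Bool
  desCond a b = (b <ᵇ a) ∧ isEven a

  risCond : ℕ → ℕ → Bool
  risCond a b = (a <ᵇ b) ∧ isEven a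

  module Des (N : ℕ) = AdjacentStatistic N desCond desE refl (λ _ → refl) (λ _ _ _ → refl)
  module Ris (N : ℕ) = AdjacentStatistic N risCond risE refl (λ _ → refl) (λ _ _ _ → refl)

  module DesChains (N : ℕ) where
    open Des N

    chainsBelow : ℕ → ℕ → ℤ
    chainsBelow M r = sumList (letters M) (λ b → chains b r)

    chains-suc : ∀ a r → a ≤ suc N → chains a (suc r) ≡ (if isEven a then chainsBelow (a ∸ 1) r else + 0)
    chains-suc a r a≤ with isEven a
    ... | true  = trans (sumList-cong (letters N) (λ b → cong (if_then chains b r else + 0) (Boolₚ.∧-identityʳ (b <ᵇ a))))
                        (sumList-letters-below N a (λ b → chains b r) a≤)
    ... | false = sumList-zero (letters N) _ (λ b → cong (if_then chains b r else + 0) (Boolₚ.∧-zeroʳ (b <ᵇ a)))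

    chains-even : ∀ j r → 2 ℕ.+ 2 ℕ.* j ≤ suc N → chains (2 ℕ.+ 2 ℕ.* j) (suc r) ≡ chainsBelow (1 ℕ.+ 2 ℕ.* j) r
    chains-even j r le = trans (chains-suc (2 ℕ.+ 2 ℕ.* j) r le)
      (cong (if_then chainsBelow (1 ℕ.+ 2 ℕ.* j) r else + 0) (trans (isEven-suc-suc (2 ℕ.* j)) (isEven-double j)))

    chains-odd : ∀ j r → 3 ℕ.+ 2 ℕ.* j ≤ suc N → chains (3 ℕ.+ 2 ℕ.* j) (suc r) ≡ + 0
    chains-odd j r le = trans (chains-suc (3 ℕ.+ 2 ℕ.* j) r le)
      (cong (if_then chainsBelow (2 ℕ.+ 2 ℕ.* j) r else + 0) (trans (isEven-suc-suc (suc (2 ℕ.* j))) (isEven-suc-double j)))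

    chainsBelow-odd : ∀ j → suc (2 ℕ.* j) ≤ N → ∀ r → chainsBelow (suc (2 ℕ.* j)) r ≡ ℓ j r
    chainsBelow-odd zero    _  zero    = refl
    chainsBelow-odd zero    _  (suc r) = cong (_+ + 0) (chains-suc 1 r (s≤s z≤n))
    chainsBelow-odd (suc j) le r = begin
      chainsBelow (suc (2 ℕ.* suc j)) r
        ≡⟨ cong (λ M → chainsBelow (suc M) r) (ℕₚ.*-suc 2 j) ⟩
      chainsBelow (3 ℕ.+ 2 ℕ.* j) r
        ≡⟨ trans (sumList-letters-suc (2 ℕ.+ 2 ℕ.* j) (λ b → chains b r))
                 (cong (_+ chains (3 ℕ.+ 2 ℕ.* j) r) (sumList-letters-suc (1 ℕ.+ 2 ℕ.* j) (λ b → chains b r))) ⟩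
      chainsBelow (1 ℕ.+ 2 ℕ.* j) r + chains (2 ℕ.+ 2 ℕ.* j) r + chains (3 ℕ.+ 2 ℕ.* j) r
        ≡⟨ two-more r ⟩
      ℓ (suc j) r ∎
      where
      le′ : 3 ℕ.+ 2 ℕ.* j ≤ N
      le′ = subst (λ M → suc M ≤ N) (ℕₚ.*-suc 2 j) le
      IH = chainsBelow-odd j (ℕₚ.≤-trans (ℕₚ.n≤1+n _) (ℕₚ.≤-trans (ℕₚ.n≤1+n _) le′))
      two-more : ∀ r →
        chainsBelow (1 ℕ.+ 2 ℕ.* j) r + chains (2 ℕ.+ 2 ℕ.* j) r + chains (3 ℕ.+ 2 ℕ.* j) r ≡ ℓ (suc j) r
      two-more zero    = begin
        chainsBelow (1 ℕ.+ 2 ℕ.* j) 0 + + 1 + + 1      ≡⟨ cong (λ x → x + + 1 + + 1) (IH 0) ⟩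
        + 1 + + 2 * + binom j 1 + + 1 + + 1            ≡⟨ regroup (+ binom j 1) ⟩
        + 1 + + 2 * (+ 1 + + binom j 1)                ≡⟨ cong (λ x → + 1 + + 2 * x) (sym (ℤₚ.pos-+ 1 (binom j 1))) ⟩
        ℓ (suc j) 0                                    ∎
        where
        regroup : ∀ b → + 1 + + 2 * b + + 1 + + 1 ≡ + 1 + + 2 * (+ 1 + b)
        regroup = solve-∀
      two-more (suc r) = begin
        chainsBelow (1 ℕ.+ 2 ℕ.* j) (suc r) + chains (2 ℕ.+ 2 ℕ.* j) (suc r) + chains (3 ℕ.+ 2 ℕ.* j) (suc r)
          ≡⟨ cong₂ (λ x y → chainsBelow (1 ℕ.+ 2 ℕ.* j) (suc r) + x + y)
                   (chains-even j r (ℕₚ.≤-trans (ℕₚ.n≤1+n _) (ℕₚ.m≤n⇒m≤1+n le′)))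
                   (chains-odd j r (ℕₚ.m≤n⇒m≤1+n le′)) ⟩
        chainsBelow (1 ℕ.+ 2 ℕ.* j) (suc r) + chainsBelow (1 ℕ.+ 2 ℕ.* j) r + + 0
          ≡⟨ cong₂ (λ x y → x + y + + 0) (IH (suc r)) (IH r) ⟩
        ℓ j (suc r) + ℓ j r + + 0
          ≡⟨ pascal (+ binom j r) (+ binom j (suc r)) (+ binom j (suc (suc r))) ⟩
        (+ binom j r + + binom j (suc r)) + + 2 * (+ binom j (suc r) + + binom j (suc (suc r)))
          ≡⟨ sym (cong₂ (λ x y → x + + 2 * y) (ℤₚ.pos-+ (binom j r) _) (ℤₚ.pos-+ (binom j (suc r)) _)) ⟩
        ℓ (suc j) (suc r) ∎
        where
        pascal : ∀ a b c → b + + 2 * c + (a + + 2 * b) + + 0 ≡ (a + b) + + 2 * (b + c)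
        pascal = solve-∀

  module Complement (k : ℕ) where
    N = suc (2 ℕ.* k)
    module D = Des N
    module R = Ris N

    complement : ℕ → ℕ
    complement a = suc N ∸ a

    isEven-complement : ∀ {a} → a ≤ suc N → isEven (complement a) ≡ isEven a
    isEven-complement {a} a≤ = trans (cong (λ M → isEven (M ∸ a)) (sym (ℕₚ.*-suc 2 k)))
                                  (isEven-double∸ (suc k) a (subst (a ≤_) (sym (ℕₚ.*-suc 2 k)) a≤))

    chains-complement : ∀ r a → a ≤ N → R.chains a r ≡ D.chains (complement a) r
    chains-complement zero    a a≤N = refl
    chains-complement (suc r) a a≤N = begin
      sumList (letters N) (λ b → if risCond a b then R.chains b r else + 0)
        ≡⟨ sumList-letters-cong N (λ b b≤N →
             trans (cong (if risCond a b then_else + 0) (chains-complement r b b≤N))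
                   (cong (λ b′ → if risCond a b′ then D.chains (complement b) r else + 0)
                         (sym (ℕₚ.m∸[m∸n]≡n (ℕₚ.m≤n⇒m≤1+n b≤N))))) ⟩
      sumList (letters N) (λ b → summand (complement b))
        ≡⟨ sumList-letters-complement N summand ⟩
      sumList (letters N) summand
        ≡⟨ sumList-letters-cong N (λ b b≤N → cong₂ (λ x y → if x ∧ y then D.chains b r else + 0)
                                                   (<ᵇ-complement (ℕₚ.m≤n⇒m≤1+n a≤N) (ℕₚ.m≤n⇒m≤1+n b≤N))
                                                   (sym (isEven-complement (ℕₚ.m≤n⇒m≤1+n a≤N)))) ⟩
      sumList (letters N) (λ b → if desCond (complement a) b then D.chains b r else + 0) ∎
      where
      summand : ℕ → ℤ
      summand b = if risCond a (complement b) then D.chains b r else + 0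

    totalChains-ris≡des : ∀ r → R.totalChains r ≡ D.totalChains r
    totalChains-ris≡des r =
      trans (sumList-letters-cong N (λ b b≤N → chains-complement r b b≤N))
            (sumList-letters-complement N (λ b → D.chains b r))

  desE-recurrence : ∀ k → Recurrence (ℓ k) (Des.X (suc (2 ℕ.* k)))
  desE-recurrence k =
    Recurrence-cong (DesChains.chainsBelow-odd (suc (2 ℕ.* k)) k ℕₚ.≤-refl) (Des.X-recurrence (suc (2 ℕ.* k)))

  risE-recurrence : ∀ k → Recurrence (ℓ k) (Ris.X (suc (2 ℕ.* k)))
  risE-recurrence k = Recurrence-cong
    (λ r → trans (Complement.totalChains-ris≡des k r) (DesChains.chainsBelow-odd (suc (2 ℕ.* k)) k ℕₚ.≤-refl r))
    (Ris.X-recurrence (suc (2 ℕ.* k)))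


open import Data.Nat using (_*_)
open import Data.Product using (_×_; _,_)
open ClosedFormula.Formula using (Recurrence⇒formula)
open WordCounts using (desE-recurrence; risE-recurrence)

corollary5p5 : (k n p : ℕ) →
    (+ countStat desE (suc (2 * k)) n p ≡ formula k n p)
      × (+ countStat risE (suc (2 * k)) n p ≡ formula k n p)
corollary5p5 k n p = Recurrence⇒formula k (desE-recurrence k) n p , Recurrence⇒formula k (risE-recurrence k) n p
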